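{- For every integer $n\ge 7$, the matrix $C_n$ is $(k-1,k-1,1)$-coverable for $k=\sigma(n)$. In particular, for all integers $n,m\ge 7$, $\mathrm{R}_{\mathbb{B}}(C_n\otimes C_m)<\mathrm{R}_{\mathbb{B}}(C_n)\cdot\mathrm{R}_{\mathbb{B}}(C_m)$.
   Context: $C_n$ is the $n\times n$ $0,1$-matrix with zeros on the diagonal and ones elsewhere. $\sigma(n)=\min\{k : n\le\binom{k}{\lceil k/2\rceil}\}$. The Boolean rank $\mathrm{R}_{\mathbb{B}}(A)$ of a $0,1$-matrix is the smallest number of all-ones combinatorial rectangles needed to cover its $1$-entries. A collection of $0,1$-matrices covers $A$ if $A_{i,j}=1$ iff some matrix of the collection has a $1$ in entry $(i,j)$. $A$ is $(a_1,a_2,a_3)$-coverable if there exist three matrices $A_1,A_2,A_3$ with $\mathrm{R}_{\mathbb{B}}(A_i)\le a_i$ for all $i$ such that every two of them cover $A$. The Kronecker product $A\otimes B$ is the block matrix with $(i,j)$-th block $A_{i,j}B$. -}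

module Defs where

open import Data.Nat using (ℕ; _≤_; ⌈_/2⌉; _*_)
open import Data.Nat.Combinatorics using (_C_)
open import Data.Bool using (Bool; true; not; _∧_; _∨_)
open import Data.Fin using (Fin; remQuot; _≟_)
open import Data.Product using (Σ; _×_; _,_)
open import Function.Bundles using (_⇔_)
open import Relation.Binary.PropositionalEquality using (_≡_)
open import Relation.Nullary using (does)

Mat : ℕ → ℕ → Set
Mat r c = Fin r → Fin c → Bool

Cmat : (n : ℕ) → Mat n n
Cmat n i j = not (does (i ≟ j))

-- Kronecker product: the (i,j)-th block is A i j · B.
-- Row index x of A ⊗ B corresponds to (i,p) with x = i * r' + p.
kron : ∀ {r c r' c'} → Mat r c → Mat r' c' → Mat (r * r') (c * c')
kron {r' = r'} {c' = c'} A B x y with remQuot r' x | remQuot c' y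
... | i , p | j , q = A i j ∧ B p q

RectCover : ∀ {r c} → Mat r c → ℕ → Set
RectCover {r} {c} A k =
  Σ (Fin k → Fin r → Bool) λ rows →
  Σ (Fin k → Fin c → Bool) λ cols →
    ∀ i j → (A i j ≡ true) ⇔ Σ (Fin k) (λ t → (rows t i ≡ true) × (cols t j ≡ true))

BoolRankAtMost : ∀ {r c} → Mat r c → ℕ → Set
BoolRankAtMost A k = RectCover A k

IsBoolRank : ∀ {r c} → Mat r c → ℕ → Set
IsBoolRank A k = RectCover A k × (∀ l → RectCover A l → k ≤ l)

IsSigma : ℕ → ℕ → Set
IsSigma n k = (n ≤ k C ⌈ k /2⌉) × (∀ l → n ≤ l C ⌈ l /2⌉ → k ≤ l)

Coverable : ∀ {r c} → Mat r c → ℕ → ℕ → ℕ → Set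
Coverable {r} {c} A a₁ a₂ a₃ =
  Σ (Mat r c) λ A₁ → Σ (Mat r c) λ A₂ → Σ (Mat r c) λ A₃ →
    BoolRankAtMost A₁ a₁ × BoolRankAtMost A₂ a₂ × BoolRankAtMost A₃ a₃ ×
    (∀ i j → A i j ≡ A₁ i j ∨ A₂ i j) ×
    (∀ i j → A i j ≡ A₁ i j ∨ A₃ i j) ×
    (∀ i j → A i j ≡ A₂ i j ∨ A₃ i j)

-- A cover of C n by r rectangles yields an antichain of n subsets of the r rectangles (the
-- rectangles meeting each row), so n ≤ r C ⌈ r /2⌉ by Sperner's theorem, proved here through
-- the Lubell–Yamamoto–Meshalkin inequality.  Conversely, if n ≤ (m + 1) C ⌈ (m + 1) /2⌉ (as for
-- m + 1 = σ(n), or for m + 1 = R_B(C n) by the above) and a = ⌊ m /2⌋ ≥ 2, the points of C n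
-- can be labelled injectively by a-subsets (rows) and (a + 1)-subsets (columns) of an m-set.  Two non-inclusion matrices, one of them relabelling
-- each row set p by a rotation of p that moves at least two points out of p, together with the
-- rectangle rows × columns, make C n (m, m, 1)-coverable.  Such a rotation exists because the
-- rotations of p move ∣ p ∣ (m − ∣ p ∣) > m − 1 points out of p in total.  Finally an
-- (a₁, a₂, a₃)- and a (b₁, b₂, b₃)-coverable matrix have a Kronecker product of Boolean rank at
-- most a₁ b₃ + a₂ b₂ + a₃ b₁, which for C n ⊗ C m gives (x + 1)(y + 1) − 1 with x + 1, y + 1
-- the Boolean ranks of C n and C m.

module Submission where

open import Defs
open import Data.Bool using (Bool; true; false; not; _∧_; _∨_; if_then_else_)
import Data.Bool as Bool
open import Data.Bool.Properties using (not-injective)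
open import Data.Empty using (⊥-elim)
open import Data.Fin using (Fin; zero; suc; splitAt; join; combine; remQuot; inject≤; inject₁; toℕ; cast; _≟_)
open import Data.Fin.Properties
  using (splitAt-join; join-splitAt; remQuot-combine; inject≤-injective; cast-is-id; cast-trans; toℕ-inject₁; toℕ<n)
open import Data.Fin.Subset using (Subset; inside; outside; ⊤; ∁; _─_; ∣_∣)
open import Data.Fin.Subset.Properties using (_⊆?_; ⊆-refl; ⊆⊤; ∣p∣≤n; ∣p∣≡n⇒p≡⊤; ∣⊤∣≡n; ∣∁p∣≡n∸∣p∣)
open import Data.List using (List; []; _∷_; length)
import Data.List as List
open import Data.List.Properties using (length-tabulate)
open import Data.List.Relation.Unary.All using (All; []; _∷_)
open import Data.List.Relation.Unary.AllPairs using (AllPairs; []; _∷_)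
open import Data.List.Relation.Unary.AllPairs.Properties using (tabulate⁺)
open import Data.Nat using (ℕ; zero; suc; _+_; _*_; _∸_; _≤_; _<_; z≤n; s≤s; _!; ⌊_/2⌋; ⌈_/2⌉)
open import Data.Nat.Combinatorics using (_C_; k![n∸k]!∣n!; nCk+nC[k+1]≡[n+1]C[k+1])
open import Data.Nat.Combinatorics.Specification using (nCk≡n!/k![n-k]!)
open import Data.Nat.DivMod using (_/_; m/n*n≡m)
open import Data.Nat.ListAction using () renaming (sum to sumˡ)
open import Data.Nat.Properties hiding (_≟_)
open import Algebra.Properties.Semiring.Sum +-*-semiring
  using (sum; sum-syntax; ∑-distrib-+; ∑-comm; sum-cong-≗; *-distribˡ-sum; *-distribʳ-sum)
open import Data.Nat.Tactic.RingSolver using (solve-∀)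
open import Data.Product using (Σ; ∃; _×_; _,_; proj₁; proj₂)
open import Data.Sum using (_⊎_; inj₁; inj₂; [_,_]′)
open import Data.Vec using (Vec; []; _∷_; _∷ʳ_; lookup; removeAt; head; zipWith)
import Data.Vec as Vec
open import Data.Vec.Properties using (≡-dec; lookup∘tabulate; ∷-injectiveʳ; ∷ʳ-injective)
open import Function using (_∘_)
open import Function.Bundles using (_⇔_; mk⇔; module Equivalence)
open import Relation.Binary.PropositionalEquality
open import Relation.Nullary using (does; ¬_; yes; no)
open import Relation.Nullary.Decidable using (dec-true; dec-false; does-⇔; from-no)

∑-mono-≤ : ∀ {n} {f g : Fin n → ℕ} → (∀ i → f i ≤ g i) → sum f ≤ sum g
∑-mono-≤ {zero} _ = z≤n
∑-mono-≤ {suc n} f≤g = +-mono-≤ (f≤g zero) (∑-mono-≤ (f≤g ∘ suc))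

∑-const : ∀ n c → ∑[ i < n ] c ≡ n * c
∑-const zero c = refl
∑-const (suc n) c = cong (c +_) (∑-const n c)

-- does (p ⊆? q) reduces along the two vectors, so facts about _⊆ᵇ_ follow by pattern matching.
_⊆ᵇ_ : ∀ {m} → Subset m → Subset m → Bool
p ⊆ᵇ q = does (p ⊆? q)

Incomparable : ∀ {m} → Subset m → Subset m → Set
Incomparable p q = (p ⊆ᵇ q ≡ false) × (q ⊆ᵇ p ≡ false)

⊆ᵇ-refl : ∀ {m} (p : Subset m) → p ⊆ᵇ p ≡ true
⊆ᵇ-refl p = dec-true (p ⊆? p) ⊆-refl

⊆ᵇ-⊤ : ∀ {m} (p : Subset m) → p ⊆ᵇ ⊤ ≡ true
⊆ᵇ-⊤ p = dec-true (p ⊆? ⊤) ⊆⊤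

⊈ᵇ⇒∃ : ∀ {m} (p q : Subset m) → p ⊆ᵇ q ≡ false → ∃ λ t → (lookup p t ≡ true) × (lookup q t ≡ false)
⊈ᵇ⇒∃ [] [] ()
⊈ᵇ⇒∃ (inside ∷ p) (outside ∷ q) _ = zero , refl , refl
⊈ᵇ⇒∃ (inside ∷ p) (inside ∷ q) e with ⊈ᵇ⇒∃ p q e
... | t , pt , qt = suc t , pt , qt
⊈ᵇ⇒∃ (outside ∷ p) (_ ∷ q) e with ⊈ᵇ⇒∃ p q e
... | t , pt , qt = suc t , pt , qt

∃⇒⊈ᵇ : ∀ {m} (p q : Subset m) (t : Fin m) → lookup p t ≡ true → lookup q t ≡ false → p ⊆ᵇ q ≡ false
∃⇒⊈ᵇ (inside ∷ p) (outside ∷ q) _ _ _ = refl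
∃⇒⊈ᵇ (inside ∷ p) (inside ∷ q) (suc t) pt qt = ∃⇒⊈ᵇ p q t pt qt
∃⇒⊈ᵇ (outside ∷ p) (_ ∷ q) (suc t) pt qt = ∃⇒⊈ᵇ p q t pt qt

⊆ᵇ⇒∣∣≤ : ∀ {m} (p q : Subset m) → p ⊆ᵇ q ≡ true → ∣ p ∣ ≤ ∣ q ∣
⊆ᵇ⇒∣∣≤ [] [] _ = z≤n
⊆ᵇ⇒∣∣≤ (inside ∷ p) (inside ∷ q) e = s≤s (⊆ᵇ⇒∣∣≤ p q e)
⊆ᵇ⇒∣∣≤ (outside ∷ p) (inside ∷ q) e = m≤n⇒m≤1+n (⊆ᵇ⇒∣∣≤ p q e)
⊆ᵇ⇒∣∣≤ (outside ∷ p) (outside ∷ q) e = ⊆ᵇ⇒∣∣≤ p q e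

∣∣<⇒⊈ᵇ : ∀ {m} (p q : Subset m) → ∣ q ∣ < ∣ p ∣ → p ⊆ᵇ q ≡ false
∣∣<⇒⊈ᵇ p q q<p with p ⊆ᵇ q in p⊆q
... | false = refl
... | true = ⊥-elim (<⇒≱ q<p (⊆ᵇ⇒∣∣≤ p q p⊆q))

⊆ᵇ-antisym-∣∣ : ∀ {m} (p q : Subset m) → p ⊆ᵇ q ≡ true → ∣ p ∣ ≡ ∣ q ∣ → p ≡ q
⊆ᵇ-antisym-∣∣ [] [] _ _ = refl
⊆ᵇ-antisym-∣∣ (inside ∷ p) (inside ∷ q) e w = cong (inside ∷_) (⊆ᵇ-antisym-∣∣ p q e (suc-injective w))
⊆ᵇ-antisym-∣∣ (outside ∷ p) (outside ∷ q) e w = cong (outside ∷_) (⊆ᵇ-antisym-∣∣ p q e w)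
⊆ᵇ-antisym-∣∣ (outside ∷ p) (inside ∷ q) e w = ⊥-elim (<⇒≱ (≤-reflexive (sym w)) (⊆ᵇ⇒∣∣≤ p q e))

≢∧∣∣≡⇒incomparable : ∀ {m} {p q : Subset m} → p ≢ q → ∣ p ∣ ≡ ∣ q ∣ → Incomparable p q
≢∧∣∣≡⇒incomparable {p = p} {q} p≢q w = ⊈ p q p≢q w , ⊈ q p (p≢q ∘ sym) (sym w)
  where
  ⊈ : ∀ p q → p ≢ q → ∣ p ∣ ≡ ∣ q ∣ → p ⊆ᵇ q ≡ false
  ⊈ p q p≢q w with p ⊆ᵇ q in p⊆q
  ... | false = refl
  ... | true = ⊥-elim (p≢q (⊆ᵇ-antisym-∣∣ p q p⊆q w))

∣∣+∣─∣≤ : ∀ {m} (p q r : Subset m) → p ⊆ᵇ r ≡ true → q ⊆ᵇ r ≡ true → ∣ p ∣ + ∣ q ─ p ∣ ≤ ∣ r ∣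
∣∣+∣─∣≤ [] [] [] _ _ = z≤n
∣∣+∣─∣≤ (inside ∷ p) (inside ∷ q) (inside ∷ r) e e' = s≤s (∣∣+∣─∣≤ p q r e e')
∣∣+∣─∣≤ (inside ∷ p) (outside ∷ q) (inside ∷ r) e e' = s≤s (∣∣+∣─∣≤ p q r e e')
∣∣+∣─∣≤ (outside ∷ p) (inside ∷ q) (inside ∷ r) e e' =
  ≤-trans (≤-reflexive (+-suc ∣ p ∣ ∣ q ─ p ∣)) (s≤s (∣∣+∣─∣≤ p q r e e'))
∣∣+∣─∣≤ (outside ∷ p) (outside ∷ q) (inside ∷ r) e e' = m≤n⇒m≤1+n (∣∣+∣─∣≤ p q r e e')
∣∣+∣─∣≤ (outside ∷ p) (outside ∷ q) (outside ∷ r) e e' = ∣∣+∣─∣≤ p q r e e'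

Antichain : ∀ {m} → List (Subset m) → Set
Antichain = AllPairs Incomparable

⊆ᵇ⊤-not-false : ∀ {m} (p : Subset m) → ¬ (p ⊆ᵇ ⊤ ≡ false)
⊆ᵇ⊤-not-false p p⊈⊤ with () ← trans (sym (⊆ᵇ-⊤ p)) p⊈⊤

antichain-⊤ : ∀ {m} {F : List (Subset m)} → Antichain F → F ≡ ⊤ ∷ [] ⊎ All (_≢ ⊤) F
antichain-⊤ [] = inj₂ []
antichain-⊤ {F = X ∷ F} (X# ∷ F#) with ≡-dec Bool._≟_ X ⊤ | antichain-⊤ F#
... | yes refl | _ = inj₁ (cong (⊤ ∷_) (nothing-incomparable-with-⊤ X#))
  where
  nothing-incomparable-with-⊤ : ∀ {G} → All (Incomparable ⊤) G → G ≡ []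
  nothing-incomparable-with-⊤ [] = refl
  nothing-incomparable-with-⊤ {Y ∷ _} ((_ , Y⊈⊤) ∷ _) = ⊥-elim (⊆ᵇ⊤-not-false Y Y⊈⊤)
... | no X≢⊤ | inj₂ F≢⊤ = inj₂ (X≢⊤ ∷ F≢⊤)
... | no _ | inj₁ refl with X#
...   | (X⊈⊤ , _) ∷ [] = ⊥-elim (⊆ᵇ⊤-not-false X X⊈⊤)

-- Sperner's theorem via the LYM inequality

lubellWeight : ∀ {m} → Subset m → ℕ
lubellWeight {m} X = ∣ X ∣ ! * (m ∸ ∣ X ∣) !

lubellSum : ∀ {m} → List (Subset m) → ℕ
lubellSum F = sumˡ (List.map lubellWeight F)

avoiding : ∀ {n} → Fin (suc n) → List (Subset (suc n)) → List (Subset n)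
avoiding x [] = []
avoiding x (X ∷ F) = if lookup X x then avoiding x F else removeAt X x ∷ avoiding x F

∣removeAt∣ : ∀ {n} (X : Subset (suc n)) x → lookup X x ≡ false → ∣ removeAt X x ∣ ≡ ∣ X ∣
∣removeAt∣ (outside ∷ X) zero _ = refl
∣removeAt∣ {suc n} (inside ∷ X@(_ ∷ _)) (suc x) X∌x = cong suc (∣removeAt∣ X x X∌x)
∣removeAt∣ {suc n} (outside ∷ X@(_ ∷ _)) (suc x) X∌x = ∣removeAt∣ X x X∌x

removeAt-⊆ᵇ : ∀ {n} (X Y : Subset (suc n)) x → lookup X x ≡ false → lookup Y x ≡ false →
  removeAt X x ⊆ᵇ removeAt Y x ≡ X ⊆ᵇ Y
removeAt-⊆ᵇ (outside ∷ X) (outside ∷ Y) zero _ _ = refl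
removeAt-⊆ᵇ {suc n} (inside ∷ X@(_ ∷ _)) (inside ∷ Y@(_ ∷ _)) (suc x) X∌x Y∌x = removeAt-⊆ᵇ X Y x X∌x Y∌x
removeAt-⊆ᵇ {suc n} (inside ∷ X@(_ ∷ _)) (outside ∷ Y@(_ ∷ _)) (suc x) _ _ = refl
removeAt-⊆ᵇ {suc n} (outside ∷ X@(_ ∷ _)) (_ ∷ Y@(_ ∷ _)) (suc x) X∌x Y∌x = removeAt-⊆ᵇ X Y x X∌x Y∌x

avoiding-antichain : ∀ {n} (x : Fin (suc n)) {F} → Antichain F → Antichain (avoiding x F)
avoiding-antichain x [] = []
avoiding-antichain x {X ∷ F} (X# ∷ F#) with lookup X x in X∌x
... | true = avoiding-antichain x F#
... | false = incomparable-avoiding X# ∷ avoiding-antichain x F#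
  where
  incomparable-avoiding : ∀ {G} → All (Incomparable X) G → All (Incomparable (removeAt X x)) (avoiding x G)
  incomparable-avoiding [] = []
  incomparable-avoiding {Y ∷ G} ((X⊈Y , Y⊈X) ∷ XG) with lookup Y x in Y∌x
  ... | true = incomparable-avoiding XG
  ... | false = (trans (removeAt-⊆ᵇ X Y x X∌x Y∌x) X⊈Y , trans (removeAt-⊆ᵇ Y X x Y∌x X∌x) Y⊈X)
              ∷ incomparable-avoiding XG

∑-outside : ∀ {m} (X : Subset m) c → ∑[ x < m ] (if lookup X x then 0 else c) ≡ ∣ ∁ X ∣ * c
∑-outside [] c = refl
∑-outside (inside ∷ X) c = ∑-outside X c
∑-outside (outside ∷ X) c = cong (c +_) (∑-outside X c)

module _ {n : ℕ} where

  reducedWeight : Subset (suc n) → ℕ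
  reducedWeight X = ∣ X ∣ ! * (n ∸ ∣ X ∣) !

  lubellSum-avoiding-∷ : ∀ x X F → lubellSum (avoiding x (X ∷ F))
    ≡ (if lookup X x then 0 else reducedWeight X) + lubellSum (avoiding x F)
  lubellSum-avoiding-∷ x X F with lookup X x in X∌x
  ... | true = refl
  ... | false = cong (λ w → w ! * (n ∸ w) ! + lubellSum (avoiding x F)) (∣removeAt∣ X x X∌x)

  -- X ≢ ⊤ survives, with weight reducedWeight X, in avoiding x for each of the
  -- ∣ ∁ X ∣ = 1 + (n ∸ ∣ X ∣) points x ∉ X.
  ∣∁∣*reducedWeight : ∀ X → X ≢ ⊤ → ∣ ∁ X ∣ * reducedWeight X ≡ lubellWeight X
  ∣∁∣*reducedWeight X X≢⊤ = begin
      ∣ ∁ X ∣ * (j ! * d !)        ≡⟨ cong (_* (j ! * d !)) ∣∁X∣≡1+d ⟩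
      suc d * (j ! * d !)          ≡⟨ *-comm (suc d) _ ⟩
      (j ! * d !) * suc d          ≡⟨ *-assoc (j !) (d !) (suc d) ⟩
      j ! * (d ! * suc d)          ≡⟨ cong (j ! *_) (*-comm (d !) (suc d)) ⟩
      j ! * suc d !                ≡⟨ cong (λ e → j ! * e !) (sym 1+n∸j≡1+d) ⟩
      j ! * (suc n ∸ j) !          ∎
    where
    open ≡-Reasoning
    j = ∣ X ∣
    d = n ∸ j
    j≤n : j ≤ n
    j≤n with m≤n⇒m<n∨m≡n (∣p∣≤n X)
    ... | inj₁ j<1+n = ≤-pred j<1+n
    ... | inj₂ j≡1+n = ⊥-elim (X≢⊤ (∣p∣≡n⇒p≡⊤ j≡1+n))
    1+n∸j≡1+d : suc n ∸ j ≡ suc d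
    1+n∸j≡1+d = +-∸-assoc 1 j≤n
    ∣∁X∣≡1+d : ∣ ∁ X ∣ ≡ suc d
    ∣∁X∣≡1+d = trans (∣∁p∣≡n∸∣p∣ X) 1+n∸j≡1+d

  ∑-lubellSum-avoiding : ∀ {F} → All (_≢ ⊤) F → ∑[ x < suc n ] lubellSum (avoiding x F) ≡ lubellSum F
  ∑-lubellSum-avoiding {[]} [] = trans (∑-const (suc n) 0) (*-zeroʳ (suc n))
  ∑-lubellSum-avoiding {X ∷ F} (X≢⊤ ∷ F≢⊤) = begin
      ∑[ x < suc n ] lubellSum (avoiding x (X ∷ F))
    ≡⟨ sum-cong-≗ (λ x → lubellSum-avoiding-∷ x X F) ⟩
      ∑[ x < suc n ] ((if lookup X x then 0 else reducedWeight X) + lubellSum (avoiding x F))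
    ≡⟨ ∑-distrib-+ (λ x → if lookup X x then 0 else reducedWeight X) (λ x → lubellSum (avoiding x F)) ⟩
      ∑[ x < suc n ] (if lookup X x then 0 else reducedWeight X) + ∑[ x < suc n ] lubellSum (avoiding x F)
    ≡⟨ cong₂ _+_ (∑-outside X (reducedWeight X)) (∑-lubellSum-avoiding F≢⊤) ⟩
      ∣ ∁ X ∣ * reducedWeight X + lubellSum F
    ≡⟨ cong (_+ lubellSum F) (∣∁∣*reducedWeight X X≢⊤) ⟩
      lubellSum (X ∷ F)
    ∎
    where open ≡-Reasoning

lubellSum-⊤ : ∀ m → lubellSum (⊤ {m} ∷ []) ≡ m !
lubellSum-⊤ m rewrite ∣⊤∣≡n m | n∸n≡0 m = trans (+-identityʳ _) (*-identityʳ (m !))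

lubell-yamamoto-meshalkin : ∀ {m} {F : List (Subset m)} → Antichain F → lubellSum F ≤ m !
lubell-yamamoto-meshalkin {m} F# with antichain-⊤ F#
... | inj₁ refl = ≤-reflexive (lubellSum-⊤ m)
lubell-yamamoto-meshalkin {zero} {[]} _ | inj₂ _ = z≤n
lubell-yamamoto-meshalkin {zero} {[] ∷ _} _ | inj₂ ([]≢⊤ ∷ _) = ⊥-elim ([]≢⊤ refl)
lubell-yamamoto-meshalkin {suc n} {F} F# | inj₂ F≢⊤ = begin
    lubellSum F                                 ≡⟨ ∑-lubellSum-avoiding F≢⊤ ⟨
    ∑[ x < suc n ] lubellSum (avoiding x F)     ≤⟨ ∑-mono-≤ (λ x → lubell-yamamoto-meshalkin (avoiding-antichain x F#)) ⟩
    ∑[ x < suc n ] (n !)                        ≡⟨ ∑-const (suc n) (n !) ⟩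
    suc n !                                     ∎
  where open ≤-Reasoning

centralWeight : ℕ → ℕ
centralWeight m = ⌈ m /2⌉ ! * (m ∸ ⌈ m /2⌉) !

!*!-unbalance : ∀ a b → b ≤ a → a ! * suc b ! ≤ suc a ! * b !
!*!-unbalance a b b≤a = begin
    a ! * (suc b * b !)   ≡⟨ *-assoc (a !) (suc b) (b !) ⟨
    (a ! * suc b) * b !   ≡⟨ cong (_* b !) (*-comm (a !) (suc b)) ⟩
    (suc b * a !) * b !   ≤⟨ *-monoˡ-≤ (b !) (*-monoˡ-≤ (a !) (s≤s b≤a)) ⟩
    (suc a * a !) * b !   ∎
  where open ≤-Reasoning

centralWeight-≤-balanced : ∀ d b → centralWeight (d + b + b) ≤ (d + b) ! * b !
centralWeight-≤-balanced zero b rewrite sym (n≡⌈n+n/2⌉ b) | m+n∸n≡m b b = ≤-refl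
centralWeight-≤-balanced (suc zero) b rewrite sym (n≡⌊n+n/2⌋ b) | m+n∸n≡m b b = ≤-refl
centralWeight-≤-balanced (suc (suc d)) b = begin
    centralWeight (suc (suc d) + b + b)   ≡⟨ cong centralWeight 2+d+b+b≡d+1+b+1+b ⟩
    centralWeight (d + suc b + suc b)     ≤⟨ centralWeight-≤-balanced d (suc b) ⟩
    (d + suc b) ! * suc b !               ≤⟨ !*!-unbalance (d + suc b) b (≤-trans (n≤1+n b) (m≤n+m (suc b) d)) ⟩
    suc (d + suc b) ! * b !               ≡⟨ cong (λ e → suc e ! * b !) (+-suc d b) ⟩
    (suc (suc d) + b) ! * b !             ∎
  where
  open ≤-Reasoning
  2+d+b+b≡d+1+b+1+b : suc (suc d) + b + b ≡ d + suc b + suc b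
  2+d+b+b≡d+1+b+1+b = sym (trans (cong (_+ suc b) (+-suc d b)) (cong suc (+-suc (d + b) b)))

centralWeight-≤-!*! : ∀ a b → b ≤ a → centralWeight (a + b) ≤ a ! * b !
centralWeight-≤-!*! a b b≤a =
  subst (λ e → centralWeight (e + b) ≤ e ! * b !) (m∸n+n≡m b≤a) (centralWeight-≤-balanced (a ∸ b) b)

centralWeight-minimal : ∀ m j → j ≤ m → centralWeight m ≤ j ! * (m ∸ j) !
centralWeight-minimal m j j≤m with m ∸ j ≤? j
... | yes m∸j≤j =
  subst (λ e → centralWeight e ≤ j ! * (m ∸ j) !) (m+[n∸m]≡n j≤m) (centralWeight-≤-!*! j (m ∸ j) m∸j≤j)
... | no m∸j≰j = begin
    centralWeight m                  ≡⟨ cong centralWeight (trans (+-comm (m ∸ j) j) (m+[n∸m]≡n j≤m)) ⟨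
    centralWeight (m ∸ j + j)        ≤⟨ centralWeight-≤-!*! (m ∸ j) j (≰⇒≥ m∸j≰j) ⟩
    (m ∸ j) ! * j !                  ≡⟨ *-comm ((m ∸ j) !) (j !) ⟩
    j ! * (m ∸ j) !                  ∎
  where open ≤-Reasoning

length*centralWeight≤lubellSum : ∀ {m} (F : List (Subset m)) → length F * centralWeight m ≤ lubellSum F
length*centralWeight≤lubellSum [] = z≤n
length*centralWeight≤lubellSum {m} (X ∷ F) =
  +-mono-≤ (centralWeight-minimal m ∣ X ∣ (∣p∣≤n X)) (length*centralWeight≤lubellSum F)

m!≡mC⌈m/2⌉*centralWeight : ∀ m → m ! ≡ (m C ⌈ m /2⌉) * centralWeight m
m!≡mC⌈m/2⌉*centralWeight m = sym (begin
    (m C ⌈ m /2⌉) * centralWeight m     ≡⟨ cong (_* centralWeight m) (nCk≡n!/k![n-k]! (⌈n/2⌉≤n m)) ⟩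
    m ! / centralWeight m * centralWeight m   ≡⟨ m/n*n≡m (k![n∸k]!∣n! (⌈n/2⌉≤n m)) ⟩
    m !                               ∎)
  where
  open ≡-Reasoning
  instance _ = ⌈ m /2⌉ !* (m ∸ ⌈ m /2⌉) !≢0

sperner : ∀ {m} {F : List (Subset m)} → Antichain F → length F ≤ m C ⌈ m /2⌉
sperner {m} {F} F# = *-cancelʳ-≤ (length F) (m C ⌈ m /2⌉) (centralWeight m) (begin
    length F * centralWeight m    ≤⟨ length*centralWeight≤lubellSum F ⟩
    lubellSum F                   ≤⟨ lubell-yamamoto-meshalkin F# ⟩
    m !                           ≡⟨ m!≡mC⌈m/2⌉*centralWeight m ⟩
    (m C ⌈ m /2⌉) * centralWeight m ∎)
  where
  open ≤-Reasoning
  instance _ = ⌈ m /2⌉ !* (m ∸ ⌈ m /2⌉) !≢0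

-- Rectangle covers and coverability

∧≡true⇒× : ∀ {a b} → a ∧ b ≡ true → a ≡ true × b ≡ true
∧≡true⇒× {true} {true} _ = refl , refl

∨≡true⇒⊎ : ∀ {a b} → a ∨ b ≡ true → a ≡ true ⊎ b ≡ true
∨≡true⇒⊎ {true} _ = inj₁ refl
∨≡true⇒⊎ {false} b = inj₂ b

⊎⇒∨≡true : ∀ {a b} → a ≡ true ⊎ b ≡ true → a ∨ b ≡ true
⊎⇒∨≡true (inj₁ refl) = refl
⊎⇒∨≡true {true} (inj₂ _) = refl
⊎⇒∨≡true {false} (inj₂ b) = b

module _ {r c : ℕ} where

  rectCover-cong : ∀ {A B : Mat r c} {k} → (∀ i j → A i j ≡ B i j) → RectCover A k → RectCover B k
  rectCover-cong A≡B (rows , cols , cover) =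
    rows , cols , λ i j → subst (λ e → (e ≡ true) ⇔ _) (A≡B i j) (cover i j)

  rectCover-rankOne : (R : Fin r → Bool) (C : Fin c → Bool) → RectCover (λ i j → R i ∧ C j) 1
  rectCover-rankOne R C = (λ _ → R) , (λ _ → C) , λ i j →
    mk⇔ (λ RC → zero , ∧≡true⇒× RC) (λ (_ , Ri , Cj) → cong₂ _∧_ Ri Cj)

  rectCover-∨ : ∀ {A B : Mat r c} {a b} →
    RectCover A a → RectCover B b → RectCover (λ i j → A i j ∨ B i j) (a + b)
  rectCover-∨ {A} {B} {a} {b} (rowsA , colsA , coverA) (rowsB , colsB , coverB) =
    rows ∘ splitAt a , cols ∘ splitAt a , λ i j → mk⇔ (covered i j) (covering i j)
    where
    rows : Fin a ⊎ Fin b → Fin r → Bool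
    rows = [ rowsA , rowsB ]′
    cols : Fin a ⊎ Fin b → Fin c → Bool
    cols = [ colsA , colsB ]′
    Rect : Fin r → Fin c → Fin a ⊎ Fin b → Set
    Rect i j u = rows u i ≡ true × cols u j ≡ true
    joined : ∀ {i j} u → Rect i j u → Σ (Fin (a + b)) (Rect i j ∘ splitAt a)
    joined {i} {j} u iju = join a b u , subst (Rect i j) (sym (splitAt-join a b u)) iju
    covered : ∀ i j → A i j ∨ B i j ≡ true → Σ (Fin (a + b)) (Rect i j ∘ splitAt a)
    covered i j Aij∨Bij with ∨≡true⇒⊎ Aij∨Bij
    ... | inj₁ Aij = let s , ijs = Equivalence.to (coverA i j) Aij in joined (inj₁ s) ijs
    ... | inj₂ Bij = let s , ijs = Equivalence.to (coverB i j) Bij in joined (inj₂ s) ijs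
    covering : ∀ i j → Σ (Fin (a + b)) (Rect i j ∘ splitAt a) → A i j ∨ B i j ≡ true
    covering i j (t , ijt) with splitAt a t
    ... | inj₁ s = ⊎⇒∨≡true (inj₁ (Equivalence.from (coverA i j) (s , ijt)))
    ... | inj₂ s = ⊎⇒∨≡true (inj₂ (Equivalence.from (coverB i j) (s , ijt)))

  rectCover-submatrix : ∀ {r' c'} {A : Mat r c} {k} (f : Fin r' → Fin r) (g : Fin c' → Fin c) →
    RectCover A k → RectCover (λ i j → A (f i) (g j)) k
  rectCover-submatrix f g (rows , cols , cover) =
    (λ t → rows t ∘ f) , (λ t → cols t ∘ g) , λ i j → cover (f i) (g j)

rectCover-kron : ∀ {r c r' c'} {A : Mat r c} {B : Mat r' c'} {a b} →
  RectCover A a → RectCover B b → RectCover (kron A B) (a * b)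
rectCover-kron {r} {c} {r'} {c'} {A} {B} {a} {b} (rowsA , colsA , coverA) (rowsB , colsB , coverB) =
  rows ∘ remQuot b , cols ∘ remQuot b , λ x y → mk⇔ (covered x y) (covering x y)
  where
  rows : Fin a × Fin b → Fin (r * r') → Bool
  rows (s , u) x = let i , p = remQuot r' x in rowsA s i ∧ rowsB u p
  cols : Fin a × Fin b → Fin (c * c') → Bool
  cols (s , u) y = let j , q = remQuot c' y in colsA s j ∧ colsB u q
  Rect : Fin (r * r') → Fin (c * c') → Fin a × Fin b → Set
  Rect x y su = rows su x ≡ true × cols su y ≡ true
  covered : ∀ x y → kron A B x y ≡ true → Σ (Fin (a * b)) (Rect x y ∘ remQuot b)
  covered x y AB with ∧≡true⇒× AB
  ... | Aij , Bpq with Equivalence.to (coverA _ _) Aij | Equivalence.to (coverB _ _) Bpq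
  ...   | s , is , js | u , pu , qu =
    combine s u , subst (Rect x y) (sym (remQuot-combine s u)) (cong₂ _∧_ is pu , cong₂ _∧_ js qu)
  covering : ∀ x y → Σ (Fin (a * b)) (Rect x y ∘ remQuot b) → kron A B x y ≡ true
  covering x y (t , xt , yt) with ∧≡true⇒× xt | ∧≡true⇒× yt
  ... | is , pu | js , qu =
    cong₂ _∧_ (Equivalence.from (coverA _ _) (_ , is , js)) (Equivalence.from (coverB _ _) (_ , pu , qu))

rectCover-nonInclusion : ∀ {n m} (S : Fin n → Subset m) → RectCover (λ i j → not (S i ⊆ᵇ S j)) m
rectCover-nonInclusion S = (λ t i → lookup (S i) t) , (λ t j → not (lookup (S j) t)) , λ i j →
  mk⇔ (λ i⊈j → let t , it , jt = ⊈ᵇ⇒∃ (S i) (S j) (not-injective i⊈j) in t , it , cong not jt)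
      (λ (t , it , jt) → cong not (∃⇒⊈ᵇ (S i) (S j) t it (not-injective jt)))

data PairwiseUnion : Bool → Bool → Bool → Bool → Set where
  none : PairwiseUnion false false false false
  all  : PairwiseUnion true true true true
  but₁ : PairwiseUnion true false true true
  but₂ : PairwiseUnion true true false true
  but₃ : PairwiseUnion true true true false

pairwiseUnion⁺ : ∀ {a} a₁ a₂ a₃ → a ≡ a₁ ∨ a₂ → a ≡ a₁ ∨ a₃ → a ≡ a₂ ∨ a₃ → PairwiseUnion a a₁ a₂ a₃
pairwiseUnion⁺ false false false refl _ _ = none
pairwiseUnion⁺ true true true refl _ _ = all
pairwiseUnion⁺ false true true refl _ _ = but₁
pairwiseUnion⁺ true false true refl _ _ = but₂
pairwiseUnion⁺ true true false refl _ _ = but₃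
pairwiseUnion⁺ true false false refl _ ()
pairwiseUnion⁺ false true false refl () _
pairwiseUnion⁺ false false true refl _ ()

pairwiseUnion⁻ : ∀ {a a₁ a₂ a₃} → PairwiseUnion a a₁ a₂ a₃ → (a ≡ a₁ ∨ a₂) × (a ≡ a₁ ∨ a₃) × (a ≡ a₂ ∨ a₃)
pairwiseUnion⁻ none = refl , refl , refl
pairwiseUnion⁻ all  = refl , refl , refl
pairwiseUnion⁻ but₁ = refl , refl , refl
pairwiseUnion⁻ but₂ = refl , refl , refl
pairwiseUnion⁻ but₃ = refl , refl , refl

-- The pairs (1,3), (2,2), (3,1) meet every choice of two indices on each side.
pairwiseUnion-∧ : ∀ {a a₁ a₂ a₃ b b₁ b₂ b₃} → PairwiseUnion a a₁ a₂ a₃ → PairwiseUnion b b₁ b₂ b₃ →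
  (a₁ ∧ b₃ ∨ a₂ ∧ b₂) ∨ a₃ ∧ b₁ ≡ a ∧ b
pairwiseUnion-∧ none _ = refl
pairwiseUnion-∧ all none = refl
pairwiseUnion-∧ all all = refl
pairwiseUnion-∧ all but₁ = refl
pairwiseUnion-∧ all but₂ = refl
pairwiseUnion-∧ all but₃ = refl
pairwiseUnion-∧ but₁ none = refl
pairwiseUnion-∧ but₁ all = refl
pairwiseUnion-∧ but₁ but₁ = refl
pairwiseUnion-∧ but₁ but₂ = refl
pairwiseUnion-∧ but₁ but₃ = refl
pairwiseUnion-∧ but₂ none = refl
pairwiseUnion-∧ but₂ all = refl
pairwiseUnion-∧ but₂ but₁ = refl
pairwiseUnion-∧ but₂ but₂ = refl
pairwiseUnion-∧ but₂ but₃ = refl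
pairwiseUnion-∧ but₃ none = refl
pairwiseUnion-∧ but₃ all = refl
pairwiseUnion-∧ but₃ but₁ = refl
pairwiseUnion-∧ but₃ but₂ = refl
pairwiseUnion-∧ but₃ but₃ = refl

kron-boolRankAtMost : ∀ {r c r' c'} {A : Mat r c} {B : Mat r' c'} {a₁ a₂ a₃ b₁ b₂ b₃} →
  Coverable A a₁ a₂ a₃ → Coverable B b₁ b₂ b₃ → BoolRankAtMost (kron A B) (a₁ * b₃ + a₂ * b₂ + a₃ * b₁)
kron-boolRankAtMost {r} {c} {r'} {c'} {A} {B} (A₁ , A₂ , A₃ , A₁# , A₂# , A₃# , A₁₂ , A₁₃ , A₂₃)
                                     (B₁ , B₂ , B₃ , B₁# , B₂# , B₃# , B₁₂ , B₁₃ , B₂₃) =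
  rectCover-cong entries
    (rectCover-∨ (rectCover-∨ (rectCover-kron A₁# B₃#) (rectCover-kron A₂# B₂#)) (rectCover-kron A₃# B₁#))
  where
  entries : ∀ x y → (kron A₁ B₃ x y ∨ kron A₂ B₂ x y) ∨ kron A₃ B₁ x y ≡ kron A B x y
  entries x y = let i , p = remQuot r' x ; j , q = remQuot c' y in
    pairwiseUnion-∧ (pairwiseUnion⁺ (A₁ i j) (A₂ i j) (A₃ i j) (A₁₂ i j) (A₁₃ i j) (A₂₃ i j))
                    (pairwiseUnion⁺ (B₁ p q) (B₂ p q) (B₃ p q) (B₁₂ p q) (B₁₃ p q) (B₂₃ p q))

splitAt-injective : ∀ m {n} {x y : Fin (m + n)} → splitAt m x ≡ splitAt m y → x ≡ y
splitAt-injective m {n} {x} {y} e = begin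
  x                       ≡⟨ join-splitAt m n x ⟨
  join m n (splitAt m x)  ≡⟨ cong (join m n) e ⟩
  join m n (splitAt m y)  ≡⟨ join-splitAt m n y ⟩
  y                       ∎
  where open ≡-Reasoning

cast-injective : ∀ {m n} .(eq : m ≡ n) {i j : Fin m} → cast eq i ≡ cast eq j → i ≡ j
cast-injective eq {i} {j} e = begin
  i                         ≡⟨ cast-is-id refl i ⟨
  cast refl i               ≡⟨ cast-trans eq (sym eq) i ⟨
  cast (sym eq) (cast eq i) ≡⟨ cong (cast (sym eq)) e ⟩
  cast (sym eq) (cast eq j) ≡⟨ cast-trans eq (sym eq) j ⟩
  cast refl j               ≡⟨ cast-is-id refl j ⟩
  j                         ∎
  where open ≡-Reasoning

Cmat-diag : ∀ {n} (i : Fin n) → Cmat n i i ≡ false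
Cmat-diag i = cong not (dec-true (i ≟ i) refl)

Cmat-≢ : ∀ {n} {i j : Fin n} → i ≢ j → Cmat n i j ≡ true
Cmat-≢ {i = i} {j} i≢j = cong not (dec-false (i ≟ j) i≢j)

-- S i is the set of rectangles meeting row i.  A rectangle through (i , j) misses row j,
-- because (j , j) is a zero of C n; so the S i form an antichain.
rectCover-Cmat⇒n≤rC⌈r/2⌉ : ∀ {n r} → RectCover (Cmat n) r → n ≤ r C ⌈ r /2⌉
rectCover-Cmat⇒n≤rC⌈r/2⌉ {n} {r} (rows , cols , cover) =
  subst (_≤ r C ⌈ r /2⌉) (length-tabulate S) (sperner (tabulate⁺ λ i≢j → S⊈S i≢j , S⊈S (i≢j ∘ sym)))
  where
  S : Fin n → Subset r
  S i = Vec.tabulate (λ t → rows t i)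
  S⊈S : ∀ {i j} → i ≢ j → S i ⊆ᵇ S j ≡ false
  S⊈S {i} {j} i≢j with Equivalence.to (cover i j) (Cmat-≢ i≢j)
  ... | t , it , jt = ∃⇒⊈ᵇ (S i) (S j) t (trans (lookup∘tabulate _ t) it) (trans (lookup∘tabulate _ t) j∉t)
    where
    j∉t : rows t j ≡ false
    j∉t with rows t j in jt'
    ... | false = refl
    ... | true with () ← trans (sym (Cmat-diag j)) (Equivalence.from (cover j j) (t , jt' , jt))

Cmat-inject≤ : ∀ {n N} (n≤N : n ≤ N) (i j : Fin n) → Cmat N (inject≤ i n≤N) (inject≤ j n≤N) ≡ Cmat n i j
Cmat-inject≤ n≤N i j =
  cong not (does-⇔ (mk⇔ (inject≤-injective n≤N n≤N i j) (cong (λ k → inject≤ k n≤N)))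
                   (inject≤ i n≤N ≟ inject≤ j n≤N) (i ≟ j))

coverable-Cmat-≤ : ∀ {n N a₁ a₂ a₃} → n ≤ N → Coverable (Cmat N) a₁ a₂ a₃ → Coverable (Cmat n) a₁ a₂ a₃
coverable-Cmat-≤ {n} n≤N (A₁ , A₂ , A₃ , A₁# , A₂# , A₃# , C₁₂ , C₁₃ , C₂₃) =
  restrict A₁ , restrict A₂ , restrict A₃ ,
  rectCover-submatrix ι ι A₁# , rectCover-submatrix ι ι A₂# , rectCover-submatrix ι ι A₃# ,
  restrict-≡ {A₁} {A₂} C₁₂ , restrict-≡ {A₁} {A₃} C₁₃ , restrict-≡ {A₂} {A₃} C₂₃
  where
  ι : Fin n → Fin _
  ι i = inject≤ i n≤N
  restrict : Mat _ _ → Mat n n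
  restrict A i j = A (ι i) (ι j)
  restrict-≡ : ∀ {A B : Mat _ _} → (∀ i j → Cmat _ i j ≡ A i j ∨ B i j) →
    ∀ i j → Cmat n i j ≡ restrict A i j ∨ restrict B i j
  restrict-≡ C≡A∨B i j = trans (sym (Cmat-inject≤ n≤N i j)) (C≡A∨B (ι i) (ι j))

-- The points of C (r + c) split into r rows and c columns; A₁ and A₂ are the non-inclusion
-- matrices of the labellings (rowSet ∣ colSet) and (rowPartner ∣ colSet), and A₃ is the
-- rectangle rows × columns.
record RowColumnDesign (m r c : ℕ) : Set where
  field
    rowSet rowPartner : Fin r → Subset m
    colSet : Fin c → Subset m
    rowSet-incomparable : ∀ {i i'} → i ≢ i' → rowSet i ⊆ᵇ rowSet i' ≡ false
    rowPartner-incomparable : ∀ {i i'} → i ≢ i' → rowPartner i ⊆ᵇ rowPartner i' ≡ false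
    colSet-incomparable : ∀ {j j'} → j ≢ j' → colSet j ⊆ᵇ colSet j' ≡ false
    colSet⊈rowSet : ∀ j i → colSet j ⊆ᵇ rowSet i ≡ false
    colSet⊈rowPartner : ∀ j i → colSet j ⊆ᵇ rowPartner i ≡ false
    rowSet⊈colSet⊎rowPartner⊈colSet : ∀ i j → rowSet i ⊆ᵇ colSet j ≡ false ⊎ rowPartner i ⊆ᵇ colSet j ≡ false

design-coverable : ∀ {m r c} → RowColumnDesign m r c → Coverable (Cmat (r + c)) m m 1
design-coverable {m} {r} {c} D =
  A₁ , A₂ , A₃ ,
  rectCover-nonInclusion (S ∘ splitAt r) , rectCover-nonInclusion (P ∘ splitAt r) ,
  rectCover-rankOne (R ∘ splitAt r) (C ∘ splitAt r) ,
  (λ x y → proj₁ (pairwiseUnion⁻ (entry x y))) ,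
  (λ x y → proj₁ (proj₂ (pairwiseUnion⁻ (entry x y)))) ,
  (λ x y → proj₂ (proj₂ (pairwiseUnion⁻ (entry x y))))
  where
  open RowColumnDesign D
  S P : Fin r ⊎ Fin c → Subset m
  S = [ rowSet , colSet ]′
  P = [ rowPartner , colSet ]′
  R C : Fin r ⊎ Fin c → Bool
  R = [ (λ _ → true) , (λ _ → false) ]′
  C = [ (λ _ → false) , (λ _ → true) ]′
  A₁ A₂ A₃ : Mat (r + c) (r + c)
  A₁ x y = not (S (splitAt r x) ⊆ᵇ S (splitAt r y))
  A₂ x y = not (P (splitAt r x) ⊆ᵇ P (splitAt r y))
  A₃ x y = R (splitAt r x) ∧ C (splitAt r y)
  R∧C-diag : ∀ u → R u ∧ C u ≡ false
  R∧C-diag (inj₁ _) = refl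
  R∧C-diag (inj₂ _) = refl
  offDiagonal : ∀ u v → u ≢ v → PairwiseUnion true (not (S u ⊆ᵇ S v)) (not (P u ⊆ᵇ P v)) (R u ∧ C v)
  offDiagonal (inj₁ i) (inj₁ i') u≢v
    rewrite rowSet-incomparable (u≢v ∘ cong inj₁) | rowPartner-incomparable (u≢v ∘ cong inj₁) = but₃
  offDiagonal (inj₂ j) (inj₂ j') u≢v
    rewrite colSet-incomparable (u≢v ∘ cong inj₂) = but₃
  offDiagonal (inj₂ j) (inj₁ i) _ rewrite colSet⊈rowSet j i | colSet⊈rowPartner j i = but₃
  offDiagonal (inj₁ i) (inj₂ j) _ with rowSet⊈colSet⊎rowPartner⊈colSet i j
  ... | inj₁ S⊈ rewrite S⊈ with rowPartner i ⊆ᵇ colSet j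
  ...   | true = but₂
  ...   | false = all
  offDiagonal (inj₁ i) (inj₂ j) _ | inj₂ P⊈ rewrite P⊈ with rowSet i ⊆ᵇ colSet j
  ...   | true = but₁
  ...   | false = all
  entry : ∀ x y → PairwiseUnion (Cmat (r + c) x y) (A₁ x y) (A₂ x y) (A₃ x y)
  entry x y with x ≟ y
  ... | yes refl rewrite ⊆ᵇ-refl (S (splitAt r x)) | ⊆ᵇ-refl (P (splitAt r x)) | R∧C-diag (splitAt r x) = none
  ... | no x≢y = offDiagonal (splitAt r x) (splitAt r y)
    (x≢y ∘ splitAt-injective r)

-- Layers of the Boolean lattice

pascalSplit : ∀ m k → Fin (suc m C suc k) → Fin (m C k) ⊎ Fin (m C suc k)
pascalSplit m k i = splitAt (m C k) (cast (sym (nCk+nC[k+1]≡[n+1]C[k+1] m k)) i)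

pascalSplit-injective : ∀ m k {i j} → pascalSplit m k i ≡ pascalSplit m k j → i ≡ j
pascalSplit-injective m k = cast-injective (sym (nCk+nC[k+1]≡[n+1]C[k+1] m k)) ∘ splitAt-injective (m C k)

layer : ∀ m k → Fin (m C k) → Subset m
layer zero zero _ = []
layer (suc m) zero i = outside ∷ layer m zero i
layer (suc m) (suc k) i = [ (inside ∷_) ∘ layer m k , (outside ∷_) ∘ layer m (suc k) ]′ (pascalSplit m k i)

∣layer∣ : ∀ m k i → ∣ layer m k i ∣ ≡ k
∣layer∣ zero zero _ = refl
∣layer∣ (suc m) zero i = ∣layer∣ m zero i
∣layer∣ (suc m) (suc k) i with pascalSplit m k i
... | inj₁ i' = cong suc (∣layer∣ m k i')
... | inj₂ i' = ∣layer∣ m (suc k) i'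

layer-injective : ∀ m k {i j} → layer m k i ≡ layer m k j → i ≡ j
layer-injective zero zero {zero} {zero} _ = refl
layer-injective (suc m) zero e = layer-injective m zero (∷-injectiveʳ e)
layer-injective (suc m) (suc k) {i} {j} e with pascalSplit m k i in ei | pascalSplit m k j in ej
... | inj₁ _ | inj₁ _ = pascalSplit-injective m k (trans ei (trans (cong inj₁ (layer-injective m k (∷-injectiveʳ e))) (sym ej)))
... | inj₂ _ | inj₂ _ =
  pascalSplit-injective m k (trans ei (trans (cong inj₂ (layer-injective m (suc k) (∷-injectiveʳ e))) (sym ej)))

-- Rotations

module _ {A : Set} where

  rotate : ∀ {n} → Vec A (suc n) → Vec A (suc n)
  rotate (x ∷ xs) = xs ∷ʳ x

  rotate^ : ∀ {n} → ℕ → Vec A (suc n) → Vec A (suc n)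
  rotate^ zero xs = xs
  rotate^ (suc s) xs = rotate^ s (rotate xs)

  rotate-injective : ∀ {n} {xs ys : Vec A (suc n)} → rotate xs ≡ rotate ys → xs ≡ ys
  rotate-injective {xs = x ∷ xs} {y ∷ ys} e with ∷ʳ-injective xs ys e
  ... | refl , refl = refl

  rotate^-injective : ∀ {n} s {xs ys : Vec A (suc n)} → rotate^ s xs ≡ rotate^ s ys → xs ≡ ys
  rotate^-injective zero e = e
  rotate^-injective (suc s) e = rotate-injective (rotate^-injective s e)

  rotate^-+ : ∀ {n} s r (xs : Vec A (suc n)) → rotate^ (s + r) xs ≡ rotate^ r (rotate^ s xs)
  rotate^-+ zero r xs = refl
  rotate^-+ (suc s) r xs = rotate^-+ s r (rotate xs)

  rotate^-comm : ∀ {n} s r (xs : Vec A (suc n)) → rotate^ s (rotate^ r xs) ≡ rotate^ r (rotate^ s xs)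
  rotate^-comm s r xs = begin
    rotate^ s (rotate^ r xs)   ≡⟨ rotate^-+ r s xs ⟨
    rotate^ (r + s) xs         ≡⟨ cong (λ k → rotate^ k xs) (+-comm r s) ⟩
    rotate^ (s + r) xs         ≡⟨ rotate^-+ s r xs ⟩
    rotate^ r (rotate^ s xs)   ∎
    where open ≡-Reasoning

  lookup-∷ʳ : ∀ {n} (xs : Vec A n) x (t : Fin n) → lookup (xs ∷ʳ x) (inject₁ t) ≡ lookup xs t
  lookup-∷ʳ (y ∷ xs) x zero = refl
  lookup-∷ʳ (y ∷ xs) x (suc t) = lookup-∷ʳ xs x t

  lookup-rotate^ : ∀ {n} (xs : Vec A (suc n)) (t : Fin (suc n)) → lookup xs t ≡ head (rotate^ (toℕ t) xs)
  lookup-rotate^ xs t = lookup-rotate^-at (toℕ t) xs t refl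
    where
    lookup-rotate^-at : ∀ {n} k (xs : Vec A (suc n)) t → toℕ t ≡ k → lookup xs t ≡ head (rotate^ k xs)
    lookup-rotate^-at zero (x ∷ xs) zero _ = refl
    lookup-rotate^-at {suc n} (suc k) (x ∷ xs) (suc t) t≡1+k = begin
      lookup xs t                           ≡⟨ lookup-∷ʳ xs x t ⟨
      lookup (rotate (x ∷ xs)) (inject₁ t)  ≡⟨ lookup-rotate^-at k _ (inject₁ t) (trans (toℕ-inject₁ t) (suc-injective t≡1+k)) ⟩
      head (rotate^ k (rotate (x ∷ xs)))    ∎
      where open ≡-Reasoning

  zipWith-∷ʳ : ∀ {n} (f : A → A → A) (xs ys : Vec A n) x y →
    zipWith f (xs ∷ʳ x) (ys ∷ʳ y) ≡ zipWith f xs ys ∷ʳ f x y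
  zipWith-∷ʳ f [] [] x y = refl
  zipWith-∷ʳ f (x' ∷ xs) (y' ∷ ys) x y = cong (f x' y' ∷_) (zipWith-∷ʳ f xs ys x y)

  rotate^-zipWith : ∀ {n} (f : A → A → A) s (xs ys : Vec A (suc n)) →
    rotate^ s (zipWith f xs ys) ≡ zipWith f (rotate^ s xs) (rotate^ s ys)
  rotate^-zipWith f zero xs ys = refl
  rotate^-zipWith f (suc s) (x ∷ xs) (y ∷ ys) =
    trans (cong (rotate^ s) (sym (zipWith-∷ʳ f xs ys x y))) (rotate^-zipWith f s (xs ∷ʳ x) (ys ∷ʳ y))

indicator : Bool → ℕ
indicator true = 1
indicator false = 0

∣∣≡∑ : ∀ {m} (p : Subset m) → ∣ p ∣ ≡ ∑[ t < m ] indicator (lookup p t)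
∣∣≡∑ [] = refl
∣∣≡∑ (inside ∷ p) = cong suc (∣∣≡∑ p)
∣∣≡∑ (outside ∷ p) = ∣∣≡∑ p

∣∁∣≡∑ : ∀ {m} (p : Subset m) → ∣ ∁ p ∣ ≡ ∑[ t < m ] indicator (not (lookup p t))
∣∁∣≡∑ [] = refl
∣∁∣≡∑ (inside ∷ p) = ∣∁∣≡∑ p
∣∁∣≡∑ (outside ∷ p) = cong suc (∣∁∣≡∑ p)

∣─∣≡∑ : ∀ {m} (p q : Subset m) → ∣ p ─ q ∣ ≡ ∑[ t < m ] (indicator (lookup p t) * indicator (not (lookup q t)))
∣─∣≡∑ [] [] = refl
∣─∣≡∑ (inside ∷ p) (inside ∷ q) = ∣─∣≡∑ p q
∣─∣≡∑ (inside ∷ p) (outside ∷ q) = cong suc (∣─∣≡∑ p q)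
∣─∣≡∑ (outside ∷ p) (inside ∷ q) = ∣─∣≡∑ p q
∣─∣≡∑ (outside ∷ p) (outside ∷ q) = ∣─∣≡∑ p q

∣∷ʳ∣ : ∀ {m} (p : Subset m) x → ∣ p ∷ʳ x ∣ ≡ ∣ x ∷ p ∣
∣∷ʳ∣ [] x = refl
∣∷ʳ∣ (inside ∷ p) inside = cong suc (∣∷ʳ∣ p inside)
∣∷ʳ∣ (inside ∷ p) outside = cong suc (∣∷ʳ∣ p outside)
∣∷ʳ∣ (outside ∷ p) inside = ∣∷ʳ∣ p inside
∣∷ʳ∣ (outside ∷ p) outside = ∣∷ʳ∣ p outside

∣rotate^∣ : ∀ {n} s (p : Subset (suc n)) → ∣ rotate^ s p ∣ ≡ ∣ p ∣
∣rotate^∣ zero p = refl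
∣rotate^∣ (suc s) (x ∷ p) = trans (∣rotate^∣ s (p ∷ʳ x)) (∣∷ʳ∣ p x)

∣rotate^─rotate^∣ : ∀ {n} s (p q : Subset (suc n)) → ∣ rotate^ s p ─ rotate^ s q ∣ ≡ ∣ p ─ q ∣
∣rotate^─rotate^∣ s p q = trans (cong ∣_∣ (sym (rotate^-zipWith _ s p q))) (∣rotate^∣ s (p ─ q))

∑-rotations-lookup : ∀ {n} (p : Subset (suc n)) t →
  ∑[ s < suc n ] indicator (lookup (rotate^ (toℕ s) p) t) ≡ ∣ p ∣
∑-rotations-lookup {n} p t = begin
    ∑[ s < suc n ] indicator (lookup (rotate^ (toℕ s) p) t)  ≡⟨ sum-cong-≗ (cong indicator ∘ lookup-rotated) ⟩
    ∑[ s < suc n ] indicator (lookup (rotate^ (toℕ t) p) s)  ≡⟨ ∣∣≡∑ (rotate^ (toℕ t) p) ⟨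
    ∣ rotate^ (toℕ t) p ∣                                   ≡⟨ ∣rotate^∣ (toℕ t) p ⟩
    ∣ p ∣                                                   ∎
  where
  open ≡-Reasoning
  lookup-rotated : ∀ s → lookup (rotate^ (toℕ s) p) t ≡ lookup (rotate^ (toℕ t) p) s
  lookup-rotated s = begin
    lookup (rotate^ (toℕ s) p) t                  ≡⟨ lookup-rotate^ (rotate^ (toℕ s) p) t ⟩
    head (rotate^ (toℕ t) (rotate^ (toℕ s) p))    ≡⟨ cong head (rotate^-comm (toℕ t) (toℕ s) p) ⟩
    head (rotate^ (toℕ s) (rotate^ (toℕ t) p))    ≡⟨ lookup-rotate^ (rotate^ (toℕ t) p) s ⟨
    lookup (rotate^ (toℕ t) p) s                  ∎

-- Double counting: each t ∉ p lies in exactly ∣ p ∣ of the rotations of p.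
∑-rotations-─ : ∀ {n} (p : Subset (suc n)) → ∑[ s < suc n ] ∣ rotate^ (toℕ s) p ─ p ∣ ≡ ∣ p ∣ * ∣ ∁ p ∣
∑-rotations-─ {n} p = begin
    ∑[ s < suc n ] ∣ rotate^ (toℕ s) p ─ p ∣
  ≡⟨ sum-cong-≗ {suc n} (λ s → ∣─∣≡∑ (rotate^ (toℕ s) p) p) ⟩
    ∑[ s < suc n ] ∑[ t < suc n ] (indicator (lookup (rotate^ (toℕ s) p) t) * outside-p t)
  ≡⟨ ∑-comm {suc n} {suc n} (λ s t → indicator (lookup (rotate^ (toℕ s) p) t) * outside-p t) ⟩
    ∑[ t < suc n ] ∑[ s < suc n ] (indicator (lookup (rotate^ (toℕ s) p) t) * outside-p t)
  ≡⟨ sum-cong-≗ {suc n} (λ t → sym (*-distribʳ-sum {suc n} (outside-p t) (λ s → indicator (lookup (rotate^ (toℕ s) p) t)))) ⟩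
    ∑[ t < suc n ] ((∑[ s < suc n ] indicator (lookup (rotate^ (toℕ s) p) t)) * outside-p t)
  ≡⟨ sum-cong-≗ {suc n} (λ t → cong (_* outside-p t) (∑-rotations-lookup p t)) ⟩
    ∑[ t < suc n ] (∣ p ∣ * outside-p t)
  ≡⟨ *-distribˡ-sum {suc n} ∣ p ∣ outside-p ⟨
    ∣ p ∣ * ∑[ t < suc n ] outside-p t
  ≡⟨ cong (∣ p ∣ *_) (∣∁∣≡∑ p) ⟨
    ∣ p ∣ * ∣ ∁ p ∣
  ∎
  where
  open ≡-Reasoning
  outside-p : Fin (suc n) → ℕ
  outside-p t = indicator (not (lookup p t))

firstAtLeast2 : (ℕ → ℕ) → ℕ → ℕ
firstAtLeast2 f zero = 1
firstAtLeast2 f (suc k) with 2 ≤? f 1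
... | yes _ = 1
... | no _ = suc (firstAtLeast2 (f ∘ suc) k)

firstAtLeast2-cong : ∀ k {f g : ℕ → ℕ} → (∀ s → f s ≡ g s) → firstAtLeast2 f k ≡ firstAtLeast2 g k
firstAtLeast2-cong zero f≗g = refl
firstAtLeast2-cong (suc k) {f} {g} f≗g with 2 ≤? f 1 | 2 ≤? g 1
... | yes _ | yes _ = refl
... | yes 2≤f1 | no 2≰g1 = ⊥-elim (2≰g1 (subst (2 ≤_) (f≗g 1) 2≤f1))
... | no 2≰f1 | yes 2≤g1 = ⊥-elim (2≰f1 (subst (2 ≤_) (sym (f≗g 1)) 2≤g1))
... | no _ | no _ = cong suc (firstAtLeast2-cong k (f≗g ∘ suc))

firstAtLeast2-spec : ∀ k (f : ℕ → ℕ) → 2 ≤ f (firstAtLeast2 f k) ⊎ (∀ s → s < k → f (suc s) ≤ 1)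
firstAtLeast2-spec zero f = inj₂ λ _ ()
firstAtLeast2-spec (suc k) f with 2 ≤? f 1
... | yes 2≤f1 = inj₁ 2≤f1
... | no 2≰f1 with firstAtLeast2-spec k (f ∘ suc)
...   | inj₁ found = inj₁ found
...   | inj₂ small = inj₂ λ where
  zero _ → ≤-pred (≰⇒> 2≰f1)
  (suc s) (s≤s s<k) → small s s<k

∣p─p∣≡0 : ∀ {m} (p : Subset m) → ∣ p ─ p ∣ ≡ 0
∣p─p∣≡0 [] = refl
∣p─p∣≡0 (inside ∷ p) = ∣p─p∣≡0 p
∣p─p∣≡0 (outside ∷ p) = ∣p─p∣≡0 p

-- The partner of p is its first proper rotation moving at least two points out of p. The
-- choice depends only on the rotation orbit of p, which makes partner injective.
module _ {n : ℕ} where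

  displacement : Subset (suc n) → ℕ → ℕ
  displacement p s = ∣ rotate^ s p ─ p ∣

  partnerShift : Subset (suc n) → ℕ
  partnerShift p = firstAtLeast2 (displacement p) n

  partner : Subset (suc n) → Subset (suc n)
  partner p = rotate^ (partnerShift p) p

  ∣partner∣ : ∀ p → ∣ partner p ∣ ≡ ∣ p ∣
  ∣partner∣ p = ∣rotate^∣ (partnerShift p) p

  displacement-rotate^ : ∀ r p s → displacement (rotate^ r p) s ≡ displacement p s
  displacement-rotate^ r p s =
    trans (cong (λ q → ∣ q ─ rotate^ r p ∣) (rotate^-comm s r p)) (∣rotate^─rotate^∣ r (rotate^ s p) p)

  partnerShift-rotate^ : ∀ r p → partnerShift (rotate^ r p) ≡ partnerShift p
  partnerShift-rotate^ r p = firstAtLeast2-cong n (displacement-rotate^ r p)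

  partner-injective-≤ : ∀ {p q} → partner p ≡ partner q → partnerShift p ≤ partnerShift q → p ≡ q
  partner-injective-≤ {p} {q} e a≤b = rotate^-injective a (trans e (cong (λ s → rotate^ s q) (sym a≡b)))
    where
    a = partnerShift p
    b = partnerShift q
    d = b ∸ a
    p≡rotate^dq : p ≡ rotate^ d q
    p≡rotate^dq = rotate^-injective a (begin
      rotate^ a p               ≡⟨ e ⟩
      rotate^ b q               ≡⟨ cong (λ s → rotate^ s q) (m∸n+n≡m a≤b) ⟨
      rotate^ (d + a) q         ≡⟨ rotate^-+ d a q ⟩
      rotate^ a (rotate^ d q)   ∎)
      where open ≡-Reasoning
    a≡b : a ≡ b
    a≡b = trans (cong partnerShift p≡rotate^dq) (partnerShift-rotate^ d q)

  partner-injective : ∀ {p q} → partner p ≡ partner q → p ≡ q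
  partner-injective {p} {q} e with ≤-total (partnerShift p) (partnerShift q)
  ... | inj₁ a≤b = partner-injective-≤ e a≤b
  ... | inj₂ b≤a = sym (partner-injective-≤ (sym e) b≤a)

  partner-far : ∀ p → n < ∣ p ∣ * ∣ ∁ p ∣ → 2 ≤ ∣ partner p ─ p ∣
  partner-far p n<∣p∣∣∁p∣ with firstAtLeast2-spec n (displacement p)
  ... | inj₁ found = found
  ... | inj₂ small = ⊥-elim (<⇒≱ n<∣p∣∣∁p∣ (begin
      ∣ p ∣ * ∣ ∁ p ∣                                     ≡⟨ ∑-rotations-─ p ⟨
      ∑[ s < suc n ] displacement p (toℕ s)               ≡⟨ cong (_+ ∑[ s < n ] displacement p (suc (toℕ s))) (∣p─p∣≡0 p) ⟩
      ∑[ s < n ] displacement p (suc (toℕ s))             ≤⟨ ∑-mono-≤ (λ s → small (toℕ s) (toℕ<n s)) ⟩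
      ∑[ s < n ] 1                                        ≡⟨ ∑-const n 1 ⟩
      n * 1                                               ≡⟨ *-identityʳ n ⟩
      n                                                   ∎))
    where open ≤-Reasoning

middleLayersDesign : ∀ M a → M < a * (suc M ∸ a) → RowColumnDesign (suc M) (suc M C a) (suc M C suc a)
middleLayersDesign M a M<a[m∸a] = record
  { rowSet = row
  ; rowPartner = partner ∘ row
  ; colSet = col
  ; rowSet-incomparable = λ i≢i' → proj₁ (incomparable row (layer-injective m a) ∣row∣ i≢i')
  ; rowPartner-incomparable = λ i≢i' →
      proj₁ (incomparable (partner ∘ row) (layer-injective m a ∘ partner-injective) ∣partner-row∣ i≢i')
  ; colSet-incomparable = λ j≢j' → proj₁ (incomparable col (layer-injective m (suc a)) ∣col∣ j≢j')
  ; colSet⊈rowSet = λ j i → ∣∣<⇒⊈ᵇ (col j) (row i) (subst₂ _<_ (sym (∣row∣ i)) (sym (∣col∣ j)) ≤-refl)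
  ; colSet⊈rowPartner = λ j i →
      ∣∣<⇒⊈ᵇ (col j) (partner (row i)) (subst₂ _<_ (sym (∣partner-row∣ i)) (sym (∣col∣ j)) ≤-refl)
  ; rowSet⊈colSet⊎rowPartner⊈colSet = row∪partner⊈col
  }
  where
  m = suc M
  row : Fin (m C a) → Subset m
  row = layer m a
  col : Fin (m C suc a) → Subset m
  col = layer m (suc a)
  ∣row∣ : ∀ i → ∣ row i ∣ ≡ a
  ∣row∣ = ∣layer∣ m a
  ∣col∣ : ∀ j → ∣ col j ∣ ≡ suc a
  ∣col∣ = ∣layer∣ m (suc a)
  ∣partner-row∣ : ∀ i → ∣ partner (row i) ∣ ≡ a
  ∣partner-row∣ i = trans (∣partner∣ (row i)) (∣row∣ i)
  incomparable : ∀ {k w} (S : Fin k → Subset m) → (∀ {i i'} → S i ≡ S i' → i ≡ i') → (∀ i → ∣ S i ∣ ≡ w) →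
    ∀ {i i'} → i ≢ i' → Incomparable (S i) (S i')
  incomparable S S-injective ∣S∣ i≢i' = ≢∧∣∣≡⇒incomparable (i≢i' ∘ S-injective) (trans (∣S∣ _) (sym (∣S∣ _)))
  -- p ∪ partner p has at least a + 2 elements, too many for a column set
  row∪partner⊈col : ∀ i j → row i ⊆ᵇ col j ≡ false ⊎ partner (row i) ⊆ᵇ col j ≡ false
  row∪partner⊈col i j with row i ⊆ᵇ col j in p⊆q | partner (row i) ⊆ᵇ col j in p'⊆q
  ... | false | _ = inj₁ refl
  ... | true | false = inj₂ refl
  ... | true | true = ⊥-elim (1+n≰n (subst (_≤ suc a) (+-comm a 2) (begin
      a + 2                             ≤⟨ +-monoʳ-≤ a 2≤far ⟩
      a + ∣ partner p ─ p ∣               ≡⟨ cong (_+ ∣ partner p ─ p ∣) (∣row∣ i) ⟨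
      ∣ p ∣ + ∣ partner p ─ p ∣           ≤⟨ ∣∣+∣─∣≤ p (partner p) (col j) p⊆q p'⊆q ⟩
      ∣ col j ∣                         ≡⟨ ∣col∣ j ⟩
      suc a                             ∎)))
    where
    open ≤-Reasoning
    p = row i
    m∸a≡∣∁p∣ : m ∸ a ≡ ∣ ∁ p ∣
    m∸a≡∣∁p∣ = trans (cong (m ∸_) (sym (∣row∣ i))) (sym (∣∁p∣≡n∸∣p∣ p))
    2≤far : 2 ≤ ∣ partner p ─ p ∣
    2≤far = partner-far p (subst (M <_) (cong₂ _*_ (sym (∣row∣ i)) m∸a≡∣∁p∣) M<a[m∸a])

m≤⌊m/2⌋*⌈m/2⌉ : ∀ m → 2 ≤ ⌊ m /2⌋ → m ≤ ⌊ m /2⌋ * ⌈ m /2⌉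
m≤⌊m/2⌋*⌈m/2⌉ m 2≤⌊m/2⌋ = begin
  m                        ≡⟨ ⌊n/2⌋+⌈n/2⌉≡n m ⟨
  ⌊ m /2⌋ + ⌈ m /2⌉        ≤⟨ +-monoˡ-≤ ⌈ m /2⌉ (⌊n/2⌋≤⌈n/2⌉ m) ⟩
  ⌈ m /2⌉ + ⌈ m /2⌉        ≡⟨ cong (⌈ m /2⌉ +_) (+-identityʳ ⌈ m /2⌉) ⟨
  2 * ⌈ m /2⌉              ≤⟨ *-monoˡ-≤ ⌈ m /2⌉ 2≤⌊m/2⌋ ⟩
  ⌊ m /2⌋ * ⌈ m /2⌉        ∎
  where open ≤-Reasoning

Cmat-coverable-central : ∀ {n} m → 4 ≤ m → n ≤ suc m C ⌈ suc m /2⌉ → Coverable (Cmat n) m m 1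
Cmat-coverable-central {n} m@(suc M) 4≤m n≤binom =
  coverable-Cmat-≤ (subst (n ≤_) (sym (nCk+nC[k+1]≡[n+1]C[k+1] m a)) n≤binom)
    (design-coverable (middleLayersDesign M a M<a[m∸a]))
  where
  a = ⌊ m /2⌋
  m∸a≡⌈m/2⌉ : m ∸ a ≡ ⌈ m /2⌉
  m∸a≡⌈m/2⌉ = trans (cong (_∸ a) (sym (⌊n/2⌋+⌈n/2⌉≡n m))) (m+n∸m≡n a ⌈ m /2⌉)
  M<a[m∸a] : M < a * (m ∸ a)
  M<a[m∸a] = subst (λ w → m ≤ a * w) (sym m∸a≡⌈m/2⌉) (m≤⌊m/2⌋*⌈m/2⌉ m (⌊n/2⌋-mono 4≤m))

7≤n≤kC⌈k/2⌉⇒5≤k : ∀ {n} k → 7 ≤ n → n ≤ k C ⌈ k /2⌉ → 5 ≤ k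
7≤n≤kC⌈k/2⌉⇒5≤k 0 7≤n n≤ = ⊥-elim (from-no (7 ≤? 1) (≤-trans 7≤n n≤))
7≤n≤kC⌈k/2⌉⇒5≤k 1 7≤n n≤ = ⊥-elim (from-no (7 ≤? 1) (≤-trans 7≤n n≤))
7≤n≤kC⌈k/2⌉⇒5≤k 2 7≤n n≤ = ⊥-elim (from-no (7 ≤? 2) (≤-trans 7≤n n≤))
7≤n≤kC⌈k/2⌉⇒5≤k 3 7≤n n≤ = ⊥-elim (from-no (7 ≤? 3) (≤-trans 7≤n n≤))
7≤n≤kC⌈k/2⌉⇒5≤k 4 7≤n n≤ = ⊥-elim (from-no (7 ≤? 6) (≤-trans 7≤n n≤))
7≤n≤kC⌈k/2⌉⇒5≤k (suc (suc (suc (suc (suc k))))) _ _ = s≤s (s≤s (s≤s (s≤s (s≤s z≤n))))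

Cmat-coverable : ∀ {n} k → 7 ≤ n → n ≤ k C ⌈ k /2⌉ → Coverable (Cmat n) (k ∸ 1) (k ∸ 1) 1
Cmat-coverable k 7≤n n≤binom with 7≤n≤kC⌈k/2⌉⇒5≤k k 7≤n n≤binom
... | s≤s 4≤m = Cmat-coverable-central _ 4≤m n≤binom

1+x*1+x*y+1*y≡[1+x]*[1+y] : ∀ x y → suc (x * 1 + x * y + 1 * y) ≡ suc x * suc y
1+x*1+x*y+1*y≡[1+x]*[1+y] = solve-∀

boolRank-kron-Cmat< : ∀ {n m rn rm r} → 7 ≤ n → 7 ≤ m → IsBoolRank (Cmat n) rn → IsBoolRank (Cmat m) rm →
  IsBoolRank (kron (Cmat n) (Cmat m)) r → r < rn * rm
boolRank-kron-Cmat< {rn = rn} {rm} {r} 7≤n 7≤m (Cn# , _) (Cm# , _) (_ , minimal)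
  with rectCover-Cmat⇒n≤rC⌈r/2⌉ Cn# | rectCover-Cmat⇒n≤rC⌈r/2⌉ Cm#
... | n≤ | m≤ with 7≤n≤kC⌈k/2⌉⇒5≤k rn 7≤n n≤ | 7≤n≤kC⌈k/2⌉⇒5≤k rm 7≤m m≤
... | s≤s _ | s≤s _ = begin-strict
    r                        ≤⟨ minimal _ (kron-boolRankAtMost (Cmat-coverable rn 7≤n n≤) (Cmat-coverable rm 7≤m m≤)) ⟩
    x * 1 + x * y + 1 * y    <⟨ ≤-reflexive (1+x*1+x*y+1*y≡[1+x]*[1+y] x y) ⟩
    suc x * suc y            ∎
  where
  open ≤-Reasoning
  x = rn ∸ 1
  y = rm ∸ 1

theorem5 : ((n : ℕ) → 7 ≤ n → (k : ℕ) → IsSigma n k → Coverable (Cmat n) (k ∸ 1) (k ∸ 1) 1)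
    × ((n m : ℕ) → 7 ≤ n → 7 ≤ m → (rn rm r : ℕ) → IsBoolRank (Cmat n) rn → IsBoolRank (Cmat m) rm
    → IsBoolRank (kron (Cmat n) (Cmat m)) r → r < rn * rm)
theorem5 = (λ n 7≤n k (n≤kC⌈k/2⌉ , _) → Cmat-coverable k 7≤n n≤kC⌈k/2⌉)
         , (λ n m 7≤n 7≤m rn rm r → boolRank-kron-Cmat< 7≤n 7≤m)
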